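{- For all positive integers $d,n$, the Jacobi symbol satisfies $\left(\frac{ -n}{4dn-1}\right)=-1$. In particular, if $4dn-1$ is prime, then the Legendre symbol satisfies $\left(\frac{n}{4dn-1}\right)=1$, i.e. $n$ is a quadratic residue modulo $4dn-1$. -}

module Defs where

open import Data.Nat as ℕ using (ℕ; suc)
open import Data.Nat.Primality using (Prime)
open import Data.Integer as ℤ using (ℤ; +_; -_; _-_; _*_; 0ℤ; 1ℤ; -1ℤ)
open import Data.Integer.Divisibility.Signed using (_∣_)
open import Data.Integer.Divisibility.Signed using () renaming (_∣?_ to _∣?ℤ_)
open import Data.Fin using (Fin; toℕ)
open import Data.Fin.Properties using (any?)
open import Data.List using (List; []; _∷_; foldr)
open import Data.List.Relation.Unary.All using (All)
open import Data.Product using (∃)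
open import Relation.Nullary using (Dec; yes; no)
open import Relation.Binary.PropositionalEquality using (_≡_)

-- a is a square modulo p: some x in {0,…,p-1} has x² ≡ a (mod p).
-- (Restricting x to residues 0..p-1 is no loss since every integer is
-- congruent to one of them.)
IsSquareMod : ℤ → ℕ → Set
IsSquareMod a p = ∃ λ (x : Fin p) → (+ p) ∣ ((+ toℕ x) * (+ toℕ x) - a)

isSquareMod? : (a : ℤ) (p : ℕ) → Dec (IsSquareMod a p)
isSquareMod? a p = any? (λ x → (+ p) ∣?ℤ ((+ toℕ x) * (+ toℕ x) - a))

legendre : ℤ → ℕ → ℤ
legendre a p with (+ p) ∣?ℤ a
... | yes _ = 0ℤ
... | no  _ with isSquareMod? a p
...   | yes _ = 1ℤ
...   | no  _ = -1ℤ

legendreProduct : ℤ → List ℕ → ℤ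
legendreProduct a = foldr (λ p r → legendre a p * r) 1ℤ

-- Jacobi symbol, as in its definition: for odd positive m with prime
-- factorisation m = p₁ ⋯ p_k (primes listed with multiplicity),
-- (a / m) = ∏ (a / pᵢ).  "(a / m) = s" is stated as: for every
-- factorisation of m into primes, the product of Legendre symbols is s.
JacobiIs : ℤ → ℕ → ℤ → Set
JacobiIs a m s = (ps : List ℕ) → All Prime ps →
                 foldr ℕ._*_ 1 ps ≡ m → legendreProduct a ps ≡ s

-- Schering's form of Gauss's lemma computes the Jacobi symbol (a / 2H+1) for a
-- coprime to 2H+1 as the sign ∏_{k=1}^{H} ε_k, where a·k ≡ ε_k·r_k with
-- ε_k = ±1 and 1 ≤ r_k ≤ H.  For a prime modulus this is Euler's criterion
-- (a^H ≡ ∏ ε_k, and x^H − 1 has at most H roots); for a composite modulus it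
-- follows from multiplicativity in the modulus, which reduces, via quadratic
-- reciprocity for the sign (Eisenstein's lattice-point count), to
-- multiplicativity in the numerator.
--
-- For m = 4dn − 1 ≡ 3 (mod 4) the sign of −1 is −1.  Every divisor x of
-- m + 1 = 4dn has sign 1: for odd x by reciprocity, since m ≡ −1 (mod x), and
-- for x = 2 because m ≡ 7 (mod 8) whenever n is even.

{-# OPTIONS --safe #-}
module Submission where

open import Defs
open import Data.Nat as ℕ using (ℕ; zero; suc; z≤n; s≤s; _≤_; _<_; _⊓_)
import Data.Nat.Properties as ℕP
import Data.Nat.Divisibility as ℕD
open import Data.Nat.DivMod using (_/_; _%_; m≡m%n+[m/n]*n; m%n<n; m*n/n≡m; /-monoˡ-≤; m/n*n≤m; m<n*o⇒m/o<n; m<n⇒m%n≡m)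
open import Data.Nat.Primality using (Prime; euclidsLemma; prime⇒irreducible; prime⇒nonTrivial)
open import Data.Nat.Induction using (<-wellFounded)
import Data.Nat.Tactic.RingSolver as ℕSolver
open import Data.Integer using (ℤ; +_; 0ℤ; 1ℤ; -1ℤ; _+_; _*_; -_; _-_; ∣_∣; _^_)
import Data.Integer.Properties as ℤP
open import Data.Integer.Divisibility.Signed using (_∣_; divides; ∣⇒∣ᵤ; ∣ᵤ⇒∣; ∣m∣n⇒∣m+n; ∣m⇒∣-m; ∣m∣n⇒∣m-n; ∣n⇒∣m*n; ∣m⇒∣m*n; ∣-trans)
open import Data.Integer.Divisibility.Signed using () renaming (_∣?_ to _∣?ℤ_)
open import Data.Integer.DivMod using (_%ℕ_; _/ℕ_; a≡a%ℕn+[a/ℕn]*n; n%ℕd<d)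
open import Data.Integer.Coprimality using (Coprime)
import Data.Integer.Coprimality as ℤC
open import Data.Integer.Tactic.RingSolver using (solve-∀)
open import Data.Fin as Fin using (Fin; toℕ; fromℕ<; punchOut)
open import Data.Fin.Properties using (any?; toℕ<n; toℕ-fromℕ<; toℕ-injective; punchOut-injective; <⇒notInjective)
open import Data.Fin.Permutation using (Permutation)
open import Data.Vec using (Vec; []; _∷_; replicate)
open import Data.List using ([]; _∷_; foldr)
open import Data.List.Relation.Unary.All using ([]; _∷_)
open import Data.Product using (_×_; _,_; proj₁; proj₂; ∃)
open import Data.Sum as Sum using (_⊎_; inj₁; inj₂; [_,_]′)
open import Data.Empty using (⊥-elim)
open import Function using (_∘_; Injective; Surjective)
open import Function.Bundles using (mk⤖)
open import Function.Properties.Bijection using (⤖⇒↔)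
open import Induction.WellFounded using (Acc; acc)
import Algebra.Properties.CommutativeMonoid.Sum as BigOperators
open import Level using (0ℓ)
open import Relation.Binary.Bundles using (Setoid)
import Relation.Binary.Reasoning.Setoid as SetoidReasoning
open import Relation.Nullary using (yes; no; ¬_)
open import Relation.Binary.PropositionalEquality using (_≡_; _≢_; refl; sym; trans; cong; cong₂; subst; subst₂; module ≡-Reasoning)

private
  module ∏ℤ = BigOperators ℤP.*-1-commutativeMonoid
  module ∑ℕ = BigOperators ℕP.+-0-commutativeMonoid

injective⇒surjective : ∀ {n} {f : Fin n → Fin n} → Injective _≡_ _≡_ f → Surjective _≡_ _≡_ f
injective⇒surjective {suc m} {f} f-inj y with any? (λ x → f x Fin.≟ y)
... | yes (x , fx≡y) = x , λ { refl → fx≡y }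
... | no  y∉im = ⊥-elim (<⇒notInjective ℕP.≤-refl g-inj)
  where
  g : Fin (suc m) → Fin m
  g x = punchOut (λ y≡fx → y∉im (x , sym y≡fx))
  g-inj : Injective _≡_ _≡_ g
  g-inj = f-inj ∘ punchOut-injective {i = y} _ _

_∈[1‥_] : ℕ → ℕ → Set
k ∈[1‥ n ] = 1 ≤ k × k ≤ n

∏[1‥_]_ : ℕ → (ℕ → ℤ) → ℤ
∏[1‥ n ] f = ∏ℤ.sum {n} (f ∘ suc ∘ toℕ)

∑[1‥_]_ : ℕ → (ℕ → ℕ) → ℕ
∑[1‥ n ] f = ∑ℕ.sum {n} (f ∘ suc ∘ toℕ)

index∈[1‥n] : ∀ {n} (i : Fin n) → suc (toℕ i) ∈[1‥ n ]
index∈[1‥n] i = s≤s z≤n , toℕ<n i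

∈[1‥n]⇒pred<n : ∀ {k n} → k ∈[1‥ n ] → ℕ.pred k < n
∈[1‥n]⇒pred<n {suc k} (_ , k<n) = k<n

∏-cong : ∀ n {f g : ℕ → ℤ} → (∀ k → k ∈[1‥ n ] → f k ≡ g k) → ∏[1‥ n ] f ≡ ∏[1‥ n ] g
∏-cong n f≗g = ∏ℤ.sum-cong-≗ (λ i → f≗g _ (index∈[1‥n] i))

∏-distrib : ∀ n (f g : ℕ → ℤ) → ∏[1‥ n ] (λ k → f k * g k) ≡ ∏[1‥ n ] f * ∏[1‥ n ] g
∏-distrib n f g = ∏ℤ.∑-distrib-+ {n} (f ∘ suc ∘ toℕ) (g ∘ suc ∘ toℕ)

∏-split : ∀ m n (f : ℕ → ℤ) → ∏[1‥ m ℕ.+ n ] f ≡ ∏[1‥ m ] f * ∏[1‥ n ] (λ k → f (m ℕ.+ k))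
∏-split zero    n f = sym (ℤP.*-identityˡ _)
∏-split (suc m) n f = trans (cong (f 1 *_) (∏-split m n (f ∘ suc))) (sym (ℤP.*-assoc (f 1) _ _))

∏-const : ∀ n a → ∏[1‥ n ] (λ _ → a) ≡ a ^ n
∏-const zero    a = refl
∏-const (suc n) a = cong (a *_) (∏-const n a)

∏-reindex : ∀ n (π : ℕ → ℕ) → (∀ k → k ∈[1‥ n ] → π k ∈[1‥ n ]) →
            (∀ i j → i ∈[1‥ n ] → j ∈[1‥ n ] → π i ≡ π j → i ≡ j) →
            ∀ f → ∏[1‥ n ] (f ∘ π) ≡ ∏[1‥ n ] f
∏-reindex n π π-range π-inj f = begin
  ∏[1‥ n ] (f ∘ π)                     ≡⟨ ∏ℤ.sum-cong-≗ (λ i → cong f (sym (index-πF i))) ⟩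
  ∏ℤ.sum (f ∘ suc ∘ toℕ ∘ πF)          ≡⟨ sym (∏ℤ.sum-permute (f ∘ suc ∘ toℕ) perm) ⟩
  ∏[1‥ n ] f                           ∎
  where
  open ≡-Reasoning
  πF : Fin n → Fin n
  πF i = fromℕ< (∈[1‥n]⇒pred<n (π-range _ (index∈[1‥n] i)))
  index-πF : ∀ i → suc (toℕ (πF i)) ≡ π (suc (toℕ i))
  index-πF i = trans (cong suc (toℕ-fromℕ< _)) (ℕP.suc-pred _ {{ℕ.>-nonZero (proj₁ (π-range _ (index∈[1‥n] i)))}})
  πF-inj : Injective _≡_ _≡_ πF
  πF-inj {i} {j} eq = toℕ-injective (ℕP.suc-injective
    (π-inj _ _ (index∈[1‥n] i) (index∈[1‥n] j)
      (trans (sym (index-πF i)) (trans (cong (suc ∘ toℕ) eq) (index-πF j)))))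
  perm : Permutation n n
  perm = ⤖⇒↔ (mk⤖ (πF-inj , injective⇒surjective πF-inj))

∑-cong : ∀ n {f g : ℕ → ℕ} → (∀ k → k ∈[1‥ n ] → f k ≡ g k) → ∑[1‥ n ] f ≡ ∑[1‥ n ] g
∑-cong n f≗g = ∑ℕ.sum-cong-≗ (λ i → f≗g _ (index∈[1‥n] i))

∑-const : ∀ n c → ∑[1‥ n ] (λ _ → c) ≡ n ℕ.* c
∑-const zero    c = refl
∑-const (suc n) c = cong (c ℕ.+_) (∑-const n c)

∑-distrib : ∀ n (f g : ℕ → ℕ) → ∑[1‥ n ] (λ k → f k ℕ.+ g k) ≡ ∑[1‥ n ] f ℕ.+ ∑[1‥ n ] g
∑-distrib n f g = ∑ℕ.∑-distrib-+ {n} (f ∘ suc ∘ toℕ) (g ∘ suc ∘ toℕ)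

∑-comm : ∀ m n (f : ℕ → ℕ → ℕ) → ∑[1‥ m ] (λ i → ∑[1‥ n ] (f i)) ≡ ∑[1‥ n ] (λ j → ∑[1‥ m ] (λ i → f i j))
∑-comm m n f = ∑ℕ.∑-comm {m} {n} (λ i j → f (suc (toℕ i)) (suc (toℕ j)))

infix 4 _≡_[mod_]
record _≡_[mod_] (a b : ℤ) (M : ℕ) : Set where
  constructor mk≡mod
  field M∣a-b : + M ∣ a - b
open _≡_[mod_]

≡⇒≡mod : ∀ {M a b} → a ≡ b → a ≡ b [mod M ]
≡⇒≡mod {a = a} refl = mk≡mod (divides 0ℤ (ℤP.+-inverseʳ a))

≡mod-sym : ∀ {M a b} → a ≡ b [mod M ] → b ≡ a [mod M ]
≡mod-sym {a = a} {b} (mk≡mod d) = mk≡mod (subst (_ ∣_) (neg-diff a b) (∣m⇒∣-m d))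
  where
  neg-diff : ∀ a b → - (a - b) ≡ b - a
  neg-diff = solve-∀

≡mod-trans : ∀ {M a b c} → a ≡ b [mod M ] → b ≡ c [mod M ] → a ≡ c [mod M ]
≡mod-trans {a = a} {b} {c} (mk≡mod d) (mk≡mod e) = mk≡mod (subst (_ ∣_) (telescope a b c) (∣m∣n⇒∣m+n d e))
  where
  telescope : ∀ a b c → (a - b) + (b - c) ≡ a - c
  telescope = solve-∀

≡mod-setoid : ℕ → Setoid 0ℓ 0ℓ
≡mod-setoid M = record
  { _≈_           = _≡_[mod M ]
  ; isEquivalence = record { refl = ≡⇒≡mod refl ; sym = ≡mod-sym ; trans = ≡mod-trans }
  }

module ≡mod-Reasoning (M : ℕ) = SetoidReasoning (≡mod-setoid M)


*-≡mod : ∀ {M a b c d} → a ≡ b [mod M ] → c ≡ d [mod M ] → a * c ≡ b * d [mod M ]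
*-≡mod {a = a} {b} {c} {d} (mk≡mod p) (mk≡mod q) =
  mk≡mod (subst (_ ∣_) (diff-* a b c d) (∣m∣n⇒∣m+n (∣m⇒∣m*n c p) (∣n⇒∣m*n b q)))
  where
  diff-* : ∀ a b c d → (a - b) * c + b * (c - d) ≡ a * c - b * d
  diff-* = solve-∀

*-≡modˡ : ∀ {M a b} c → a ≡ b [mod M ] → c * a ≡ c * b [mod M ]
*-≡modˡ c = *-≡mod (≡⇒≡mod {a = c} refl)

*-≡modʳ : ∀ {M a b} c → a ≡ b [mod M ] → a * c ≡ b * c [mod M ]
*-≡modʳ c a≡b = *-≡mod a≡b (≡⇒≡mod {a = c} refl)

neg-≡mod : ∀ {M a b} → a ≡ b [mod M ] → - a ≡ - b [mod M ]
neg-≡mod {a = a} {b} (mk≡mod p) = mk≡mod (subst (_ ∣_) (diff-neg a b) (∣m⇒∣-m p))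
  where
  diff-neg : ∀ a b → - (a - b) ≡ (- a) - (- b)
  diff-neg = solve-∀

≡mod-∣ : ∀ {M N a b} → N ℕD.∣ M → a ≡ b [mod M ] → a ≡ b [mod N ]
≡mod-∣ N∣M (mk≡mod d) = mk≡mod (∣-trans (∣ᵤ⇒∣ N∣M) d)

∏-≡mod : ∀ {M} n {f g : ℕ → ℤ} → (∀ k → k ∈[1‥ n ] → f k ≡ g k [mod M ]) → ∏[1‥ n ] f ≡ ∏[1‥ n ] g [mod M ]
∏-≡mod zero    f≡g = ≡⇒≡mod refl
∏-≡mod (suc n) f≡g =
  *-≡mod (f≡g 1 (s≤s z≤n , s≤s z≤n)) (∏-≡mod n (λ k (1≤k , k≤n) → f≡g (suc k) (s≤s z≤n , s≤s k≤n)))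

≡mod0⇒∣ : ∀ {M a} → a ≡ 0ℤ [mod M ] → + M ∣ a
≡mod0⇒∣ {a = a} (mk≡mod d) = subst (_ ∣_) (ℤP.+-identityʳ a) d


%ℕ-≡mod : ∀ a M .{{_ : ℕ.NonZero M}} → a ≡ + (a %ℕ M) [mod M ]
%ℕ-≡mod a M = mk≡mod (divides (a /ℕ M) (lemma _ (a /ℕ M) (+ M) (a≡a%ℕn+[a/ℕn]*n a M)))
  where
  lemma : ∀ {a} r q m → a ≡ r + q * m → a - r ≡ q * m
  lemma r q m refl = shift r q m
    where
    shift : ∀ r q m → r + q * m - r ≡ q * m
    shift = solve-∀

∣∧∣x∣<M⇒x≡0 : ∀ {M x} → + M ∣ x → ∣ x ∣ < M → x ≡ 0ℤ
∣∧∣x∣<M⇒x≡0 {M} {x} M∣x ∣x∣<M with ∣ x ∣ in eq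
... | zero  = ℤP.∣i∣≡0⇒i≡0 eq
... | suc k = ⊥-elim (ℕP.<⇒≱ ∣x∣<M (ℕD.∣⇒≤ (subst (M ℕD.∣_) eq (∣⇒∣ᵤ M∣x))))

∣r-s∣<M : ∀ {M r s} → r < M → s < M → ∣ + r - + s ∣ < M
∣r-s∣<M {M} {r} {s} r<M s<M with ℕP.≤-total r s
... | inj₁ r≤s = subst (_< M) (sym (trans (cong ∣_∣ (ℤP.m-n≡m⊖n r s)) (ℤP.∣⊖∣-≤ r≤s)))
                   (ℕP.≤-<-trans (ℕP.m∸n≤m s r) s<M)
... | inj₂ s≤r = subst (_< M) (sym (trans (cong ∣_∣ (ℤP.m-n≡m⊖n r s))
                                        (trans (ℤP.∣m⊖n∣≡∣n⊖m∣ r s) (ℤP.∣⊖∣-≤ s≤r))))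
                   (ℕP.≤-<-trans (ℕP.m∸n≤m r s) r<M)

≡mod⇒≡ : ∀ {M r s} → r < M → s < M → + r ≡ + s [mod M ] → r ≡ s
≡mod⇒≡ r<M s<M (mk≡mod d) = ℤP.+-injective (ℤP.i-j≡0⇒i≡j _ _ (∣∧∣x∣<M⇒x≡0 d (∣r-s∣<M r<M s<M)))

coprime-cancel : ∀ {M} a x → Coprime (+ M) a → + M ∣ a * x → + M ∣ x
coprime-cancel {M} a x M⊥a M∣ax = ∣ᵤ⇒∣ (ℤC.coprime-divisor (+ M) a x M⊥a (∣⇒∣ᵤ M∣ax))

coprime-≡mod : ∀ {M a b} → Coprime (+ M) a → a ≡ b [mod M ] → Coprime (+ M) b
coprime-≡mod {M} {a} {b} M⊥a (mk≡mod M∣a-b) {d} (d∣M , d∣b) =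
  M⊥a (d∣M , ∣⇒∣ᵤ (subst (+ d ∣_) (cancel a b) (∣m∣n⇒∣m+n (∣-trans (∣ᵤ⇒∣ d∣M) M∣a-b) (∣ᵤ⇒∣ d∣b))))
  where
  cancel : ∀ a b → a - b + b ≡ a
  cancel = solve-∀

coprime-∣ : ∀ {M N a} → N ℕD.∣ M → Coprime (+ M) a → Coprime (+ N) a
coprime-∣ N∣M M⊥a (d∣N , d∣a) = M⊥a (ℕD.∣-trans d∣N N∣M , d∣a)

IsSign : ℤ → Set
IsSign s = s ≡ 1ℤ ⊎ s ≡ -1ℤ

sign-* : ∀ {s t} → IsSign s → IsSign t → IsSign (s * t)
sign-* (inj₁ refl) (inj₁ refl) = inj₁ refl
sign-* (inj₁ refl) (inj₂ refl) = inj₂ refl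
sign-* (inj₂ refl) (inj₁ refl) = inj₂ refl
sign-* (inj₂ refl) (inj₂ refl) = inj₁ refl

sign-square : ∀ {s} → IsSign s → s * s ≡ 1ℤ
sign-square (inj₁ refl) = refl
sign-square (inj₂ refl) = refl

sign-cancelˡ : ∀ {s} → IsSign s → ∀ x → s * (s * x) ≡ x
sign-cancelˡ {s} s± x = trans (sym (ℤP.*-assoc s s x)) (trans (cong (_* x) (sign-square s±)) (ℤP.*-identityˡ x))

∏-sign : ∀ n {f : ℕ → ℤ} → (∀ k → IsSign (f k)) → IsSign (∏[1‥ n ] f)
∏-sign zero    f± = inj₁ refl
∏-sign (suc n) f± = sign-* (f± 1) (∏-sign n (f± ∘ suc))

sign-cancel : ∀ {P s t} → IsSign P → IsSign s → IsSign t → P ≡ s * (P * t) → s ≡ t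
sign-cancel (inj₁ refl) (inj₁ refl) (inj₁ refl) _  = refl
sign-cancel (inj₁ refl) (inj₁ refl) (inj₂ refl) ()
sign-cancel (inj₁ refl) (inj₂ refl) (inj₁ refl) ()
sign-cancel (inj₁ refl) (inj₂ refl) (inj₂ refl) _  = refl
sign-cancel (inj₂ refl) (inj₁ refl) (inj₁ refl) _  = refl
sign-cancel (inj₂ refl) (inj₁ refl) (inj₂ refl) ()
sign-cancel (inj₂ refl) (inj₂ refl) (inj₁ refl) ()
sign-cancel (inj₂ refl) (inj₂ refl) (inj₂ refl) _  = refl

sign-transpose : ∀ {x y z} → IsSign y → x * y ≡ z → x ≡ y * z
sign-transpose {x} {y} y± refl = begin
  x               ≡⟨ ℤP.*-identityʳ x ⟨
  x * 1ℤ          ≡⟨ cong (x *_) (sign-square y±) ⟨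
  x * (y * y)     ≡⟨ rearrange x y ⟩
  y * (x * y)     ∎
  where
  open ≡-Reasoning
  rearrange : ∀ x y → x * (y * y) ≡ y * (x * y)
  rearrange = solve-∀

-1^-sign : ∀ n → IsSign (-1ℤ ^ n)
-1^-sign zero    = inj₁ refl
-1^-sign (suc n) with -1^-sign n
... | inj₁ e = inj₂ (cong (-1ℤ *_) e)
... | inj₂ e = inj₁ (cong (-1ℤ *_) e)

-1^-even : ∀ n → -1ℤ ^ (2 ℕ.* n) ≡ 1ℤ
-1^-even n = trans (sym (ℤP.^-*-assoc -1ℤ 2 n)) (ℤP.^-zeroˡ n)

∏-^ : ∀ i n (f : ℕ → ℕ) → ∏[1‥ n ] (λ k → i ^ f k) ≡ i ^ ∑[1‥ n ] f
∏-^ i zero    f = refl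
∏-^ i (suc n) f = trans (cong (i ^ f 1 *_) (∏-^ i n (f ∘ suc))) (sym (ℤP.^-distribˡ-+-* i (f 1) _))

-- Least absolute residues modulo an odd number

odd : ℕ → ℕ
odd H = suc (2 ℕ.* H)

-1^-odd : ∀ H → -1ℤ ^ odd H ≡ -1ℤ
-1^-odd H = cong (-1ℤ *_) (-1^-even H)

-1^-*odd : ∀ k A → -1ℤ ^ (k ℕ.* odd A) ≡ -1ℤ ^ k
-1^-*odd k A = begin
  -1ℤ ^ (k ℕ.* odd A)                   ≡⟨ cong (-1ℤ ^_) (ℕP.*-suc k (2 ℕ.* A)) ⟩
  -1ℤ ^ (k ℕ.+ k ℕ.* (2 ℕ.* A))         ≡⟨ ℤP.^-distribˡ-+-* -1ℤ k _ ⟩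
  -1ℤ ^ k * -1ℤ ^ (k ℕ.* (2 ℕ.* A))     ≡⟨ cong (λ e → -1ℤ ^ k * -1ℤ ^ e) (ℕP.*-comm k (2 ℕ.* A)) ⟩
  -1ℤ ^ k * -1ℤ ^ (2 ℕ.* A ℕ.* k)       ≡⟨ cong (λ e → -1ℤ ^ k * -1ℤ ^ e) (ℕP.*-assoc 2 A k) ⟩
  -1ℤ ^ k * -1ℤ ^ (2 ℕ.* (A ℕ.* k))     ≡⟨ cong (-1ℤ ^ k *_) (-1^-even (A ℕ.* k)) ⟩
  -1ℤ ^ k * 1ℤ                          ≡⟨ ℤP.*-identityʳ _ ⟩
  -1ℤ ^ k                               ∎
  where open ≡-Reasoning

odd∸H : ∀ H → odd H ℕ.∸ H ≡ suc H
odd∸H H = trans (cong (ℕ._∸ H) (split H)) (ℕP.m+n∸n≡m (suc H) H)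
  where
  split : ∀ H → suc (2 ℕ.* H) ≡ suc H ℕ.+ H
  split = ℕSolver.solve-∀

x+y<odd : ∀ {H x y} → x ≤ H → y ≤ H → x ℕ.+ y < odd H
x+y<odd {H} {x} {y} x≤H y≤H = s≤s (subst (x ℕ.+ y ≤_) (cong (H ℕ.+_) (sym (ℕP.+-identityʳ H))) (ℕP.+-mono-≤ x≤H y≤H))

≤H⇒<odd : ∀ {H x} → x ≤ H → x < odd H
≤H⇒<odd {x = x} x≤H = subst (_< _) (ℕP.+-identityʳ x) (x+y<odd x≤H z≤n)

0<x<M⇒M∤x : ∀ {M x} → 1 ≤ x → x < M → ¬ (+ M ∣ + x)
0<x<M⇒M∤x 1≤x x<M d = ℕP.<⇒≢ 1≤x (sym (ℤP.+-injective (∣∧∣x∣<M⇒x≡0 d x<M)))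

odd∤[1‥H] : ∀ {H k} → k ∈[1‥ H ] → ¬ (+ odd H ∣ + k)
odd∤[1‥H] (1≤k , k≤H) = 0<x<M⇒M∤x 1≤k (≤H⇒<odd k≤H)

odd∤x+y : ∀ {H x y} → 1 ≤ x → x ≤ H → y ≤ H → ¬ (+ odd H ∣ + x + + y)
odd∤x+y {H} {x} {y} 1≤x x≤H y≤H odd∣x+y =
  0<x<M⇒M∤x (ℕP.≤-trans 1≤x (ℕP.m≤m+n x y)) (x+y<odd x≤H y≤H) (subst (+ odd H ∣_) (sym (ℤP.pos-+ x y)) odd∣x+y)

even⊎odd : ∀ n → ∃ λ j → n ≡ 2 ℕ.* j ⊎ n ≡ odd j
even⊎odd zero = 0 , inj₁ refl
even⊎odd (suc n) with even⊎odd n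
... | j , inj₁ refl = j , inj₂ refl
... | j , inj₂ refl = suc j , inj₁ (cong suc (sym (ℕP.+-suc j (j ℕ.+ 0))))

odd-injective : ∀ {H K} → odd H ≡ odd K → H ≡ K
odd-injective {H} {K} eq = ℕP.*-cancelˡ-≡ H K 2 (ℕP.suc-injective eq)

odd-factor : ∀ m n {H} → m ℕ.* n ≡ odd H → ∃ λ K → m ≡ odd K
odd-factor m n {H} mn≡odd with even⊎odd m
... | K , inj₂ m≡odd  = K , m≡odd
... | j , inj₁ refl = ⊥-elim (ℕP.even≢odd (j ℕ.* n) H (trans (sym (ℕP.*-assoc 2 j n)) mn≡odd))

≡-odd-representative : ∀ a K → ∃ λ A → a ≡ + odd A [mod odd K ]
≡-odd-representative a K with even⊎odd (a %ℕ odd K)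
... | j , inj₂ r≡odd  = j , subst (a ≡_[mod odd K ]) (cong +_ r≡odd) (%ℕ-≡mod a (odd K))
... | j , inj₁ r≡even = j ℕ.+ K , ≡mod-trans (%ℕ-≡mod a (odd K))
  (mk≡mod (divides -1ℤ (difference {+ (a %ℕ odd K)} (trans (sym (ℤP.pos-+ (a %ℕ odd K) (odd K)))
                                          (cong +_ (trans (cong (ℕ._+ odd K) r≡even) (shift j K)))))))
  where
  shift : ∀ j K → 2 ℕ.* j ℕ.+ suc (2 ℕ.* K) ≡ suc (2 ℕ.* (j ℕ.+ K))
  shift = ℕSolver.solve-∀
  difference : ∀ {x y z} → x + z ≡ y → x - y ≡ -1ℤ * z
  difference {x} {z = z} refl = rearrange x z
    where
    rearrange : ∀ x z → x - (x + z) ≡ -1ℤ * z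
    rearrange = solve-∀

foldSign : ℕ → ℕ → ℤ
foldSign H r with r ℕ.≤? H
... | yes _ = 1ℤ
... | no  _ = -1ℤ

foldAbs : ℕ → ℕ → ℕ
foldAbs H r with r ℕ.≤? H
... | yes _ = r
... | no  _ = odd H ℕ.∸ r

foldSign-≤ : ∀ {H r} → r ≤ H → foldSign H r ≡ 1ℤ
foldSign-≤ {H} {r} r≤H with r ℕ.≤? H
... | yes _   = refl
... | no  r≰H = ⊥-elim (r≰H r≤H)

foldSign-> : ∀ {H r} → H < r → foldSign H r ≡ -1ℤ
foldSign-> {H} {r} H<r with r ℕ.≤? H
... | yes r≤H = ⊥-elim (ℕP.<⇒≱ H<r r≤H)
... | no  _   = refl

foldSign-sign : ∀ H r → IsSign (foldSign H r)
foldSign-sign H r with r ℕ.≤? H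
... | yes _ = inj₁ refl
... | no  _ = inj₂ refl

foldAbs≤H : ∀ H r → r < odd H → foldAbs H r ≤ H
foldAbs≤H H r r<odd with r ℕ.≤? H
... | yes r≤H = r≤H
... | no  r≰H = ℕP.≤-trans (ℕP.∸-monoʳ-≤ (odd H) (ℕP.≰⇒> r≰H))
                          (ℕP.≤-reflexive (trans (ℕP.m+n∸m≡n H (H ℕ.+ 0)) (ℕP.+-identityʳ H)))

foldAbs≢0 : ∀ H r → r < odd H → 1 ≤ r → 1 ≤ foldAbs H r
foldAbs≢0 H r r<odd 1≤r with r ℕ.≤? H
... | yes _ = 1≤r
... | no  _ = ℕP.m<n⇒0<n∸m r<odd

fold-≡mod : ∀ H r → r < odd H → + r ≡ foldSign H r * + foldAbs H r [mod odd H ]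
fold-≡mod H r r<odd with r ℕ.≤? H
... | yes _ = ≡⇒≡mod (sym (ℤP.*-identityˡ (+ r)))
... | no  _ = mk≡mod (divides 1ℤ (begin
  + r - -1ℤ * + (odd H ℕ.∸ r)  ≡⟨ minus-negate (+ r) (+ (odd H ℕ.∸ r)) ⟩
  + r + + (odd H ℕ.∸ r)        ≡⟨ sym (ℤP.pos-+ r _) ⟩
  + (r ℕ.+ (odd H ℕ.∸ r))      ≡⟨ cong +_ (ℕP.m+[n∸m]≡n (ℕP.<⇒≤ r<odd)) ⟩
  + odd H                      ≡⟨ sym (ℤP.*-identityˡ _) ⟩
  1ℤ * + odd H                 ∎))
  where
  open ≡-Reasoning
  minus-negate : ∀ a b → a - -1ℤ * b ≡ a + b
  minus-negate = solve-∀

≡mod⇒%ℕ≡ : ∀ {M x y} .{{_ : ℕ.NonZero M}} → x ≡ y [mod M ] → x %ℕ M ≡ y %ℕ M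
≡mod⇒%ℕ≡ {M} {x} {y} x≡y = ≡mod⇒≡ (n%ℕd<d x M) (n%ℕd<d y M)
  (≡mod-trans (≡mod-sym (%ℕ-≡mod x M)) (≡mod-trans x≡y (%ℕ-≡mod y M)))

residueSign : ℕ → ℤ → ℤ
residueSign H x = foldSign H (x %ℕ odd H)

absResidue : ℕ → ℤ → ℕ
absResidue H x = foldAbs H (x %ℕ odd H)

residueSign-sign : ∀ H x → IsSign (residueSign H x)
residueSign-sign H x = foldSign-sign H (x %ℕ odd H)

residueSign-cong : ∀ H {x y} → x ≡ y [mod odd H ] → residueSign H x ≡ residueSign H y
residueSign-cong H x≡y = cong (foldSign H) (≡mod⇒%ℕ≡ x≡y)

absResidue≤H : ∀ H x → absResidue H x ≤ H
absResidue≤H H x = foldAbs≤H H (x %ℕ odd H) (n%ℕd<d x (odd H))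

≡signed-residue : ∀ H x → x ≡ residueSign H x * + absResidue H x [mod odd H ]
≡signed-residue H x = ≡mod-trans (%ℕ-≡mod x (odd H)) (fold-≡mod H (x %ℕ odd H) (n%ℕd<d x (odd H)))

absResidue≥1 : ∀ H x → ¬ (+ odd H ∣ x) → 1 ≤ absResidue H x
absResidue≥1 H x odd∤x with x %ℕ odd H in r≡
... | zero  = ⊥-elim (odd∤x (≡mod0⇒∣ (subst (x ≡_[mod odd H ]) (cong +_ r≡) (%ℕ-≡mod x (odd H)))))
... | suc r = foldAbs≢0 H (suc r) (subst (_< odd H) r≡ (n%ℕd<d x (odd H))) (s≤s z≤n)

signed-residue-unique : ∀ {H s t x y} → IsSign s → IsSign t → 1 ≤ x → x ≤ H → y ≤ H →
                        s * + x ≡ t * + y [mod odd H ] → s ≡ t × x ≡ y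
signed-residue-unique {H} {x = x} {y} (inj₁ refl) (inj₁ refl) _ x≤H y≤H sx≡ty =
  refl , ≡mod⇒≡ (≤H⇒<odd x≤H) (≤H⇒<odd y≤H) (subst₂ _≡_[mod odd H ] (ℤP.*-identityˡ _) (ℤP.*-identityˡ _) sx≡ty)
signed-residue-unique {H} {x = x} {y} (inj₂ refl) (inj₂ refl) _ x≤H y≤H sx≡ty =
  refl , ≡mod⇒≡ (≤H⇒<odd x≤H) (≤H⇒<odd y≤H) (subst₂ _≡_[mod odd H ] (negate-neg (+ x)) (negate-neg (+ y)) (neg-≡mod sx≡ty))
  where
  negate-neg : ∀ a → - (-1ℤ * a) ≡ a
  negate-neg = solve-∀
signed-residue-unique {H} {x = x} {y} (inj₁ refl) (inj₂ refl) 1≤x x≤H y≤H (mk≡mod d) =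
  ⊥-elim (odd∤x+y 1≤x x≤H y≤H (subst (+ odd H ∣_) (diff (+ x) (+ y)) d))
  where
  diff : ∀ a b → 1ℤ * a - -1ℤ * b ≡ a + b
  diff = solve-∀
signed-residue-unique {H} {x = x} {y} (inj₂ refl) (inj₁ refl) 1≤x x≤H y≤H (mk≡mod d) =
  ⊥-elim (odd∤x+y 1≤x x≤H y≤H (subst (+ odd H ∣_) (diff (+ x) (+ y)) (∣m⇒∣-m d)))
  where
  diff : ∀ a b → - (-1ℤ * a - 1ℤ * b) ≡ a + b
  diff = solve-∀

-- Gauss's sign

module _ (H : ℕ) (a : ℤ) (odd⊥a : Coprime (+ odd H) a) where

  residue-of-multiple∈[1‥H] : ∀ k → k ∈[1‥ H ] → absResidue H (a * + k) ∈[1‥ H ]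
  residue-of-multiple∈[1‥H] k k∈ =
    absResidue≥1 H (a * + k) (λ odd∣ak → odd∤[1‥H] k∈ (coprime-cancel a (+ k) odd⊥a odd∣ak)) ,
    absResidue≤H H (a * + k)

  residue-of-multiple-injective : ∀ i j → i ∈[1‥ H ] → j ∈[1‥ H ] →
                                  absResidue H (a * + i) ≡ absResidue H (a * + j) → i ≡ j
  residue-of-multiple-injective i j (1≤i , i≤H) (_ , j≤H) ρi≡ρj =
    proj₂ (signed-residue-unique (residueSign-sign H (a * + i)) (residueSign-sign H (a * + j)) 1≤i i≤H j≤H
      (mk≡mod (coprime-cancel a (sᵢ * + i - sⱼ * + j) odd⊥a (subst (+ odd H ∣_) (factor sᵢ sⱼ a (+ i) (+ j)) (M∣a-b sᵢai≡sⱼaj)))))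
    where
    sᵢ = residueSign H (a * + i)
    sⱼ = residueSign H (a * + j)
    unfold : ∀ k → residueSign H (a * + k) * (a * + k) ≡ + absResidue H (a * + k) [mod odd H ]
    unfold k = subst (residueSign H (a * + k) * (a * + k) ≡_[mod odd H ])
                     (sign-cancelˡ (residueSign-sign H (a * + k)) _)
                     (*-≡modˡ (residueSign H (a * + k)) (≡signed-residue H (a * + k)))
    sᵢai≡sⱼaj : sᵢ * (a * + i) ≡ sⱼ * (a * + j) [mod odd H ]
    sᵢai≡sⱼaj = begin
      sᵢ * (a * + i)            ≈⟨ unfold i ⟩
      + absResidue H (a * + i)  ≡⟨ cong +_ ρi≡ρj ⟩
      + absResidue H (a * + j)  ≈⟨ unfold j ⟨
      sⱼ * (a * + j)            ∎
      where open ≡mod-Reasoning (odd H)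
    factor : ∀ s t a x y → s * (a * x) - t * (a * y) ≡ a * (s * x - t * y)
    factor = solve-∀

  ∏-permute-by-residues : ∀ f → ∏[1‥ H ] (λ k → f (absResidue H (a * + k))) ≡ ∏[1‥ H ] f
  ∏-permute-by-residues = ∏-reindex H _ residue-of-multiple∈[1‥H] residue-of-multiple-injective

-- The sign (−1)^μ of Gauss's lemma, μ = #{k ≤ H : a·k has a negative least absolute residue}.
gaussSign : ℕ → ℤ → ℤ
gaussSign H a = ∏[1‥ H ] (λ k → residueSign H (a * + k))

gaussSign-sign : ∀ H a → IsSign (gaussSign H a)
gaussSign-sign H a = ∏-sign H (λ k → residueSign-sign H (a * + k))

gaussSign-cong : ∀ H {a b} → a ≡ b [mod odd H ] → gaussSign H a ≡ gaussSign H b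
gaussSign-cong H a≡b = ∏-cong H (λ k _ → residueSign-cong H (*-≡modʳ (+ k) a≡b))

residueSign-* : ∀ H a b → Coprime (+ odd H) a → Coprime (+ odd H) b → ∀ k → k ∈[1‥ H ] →
                residueSign H (a * b * + k) ≡ residueSign H (b * + k) * residueSign H (a * + absResidue H (b * + k))
residueSign-* H a b odd⊥a odd⊥b k k∈ = sym (proj₁ (signed-residue-unique
  (sign-* (residueSign-sign H (b * + k)) (residueSign-sign H (a * + r))) (residueSign-sign H (a * b * + k))
  (proj₁ r'∈) (proj₂ r'∈) (absResidue≤H H (a * b * + k)) (≡mod-sym abk≡)))
  where
  r = absResidue H (b * + k)
  s = residueSign H (b * + k)
  r'∈ = residue-of-multiple∈[1‥H] H a odd⊥a r (residue-of-multiple∈[1‥H] H b odd⊥b k k∈)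
  open ≡mod-Reasoning (odd H)
  swap : ∀ x y z → x * (y * z) ≡ y * (x * z)
  swap = solve-∀
  abk≡ : residueSign H (a * b * + k) * + absResidue H (a * b * + k)
         ≡ (s * residueSign H (a * + r)) * + absResidue H (a * + r) [mod odd H ]
  abk≡ = begin
    residueSign H (a * b * + k) * + absResidue H (a * b * + k)  ≈⟨ ≡signed-residue H (a * b * + k) ⟨
    a * b * + k                                                  ≡⟨ ℤP.*-assoc a b (+ k) ⟩
    a * (b * + k)                                                ≈⟨ *-≡modˡ a (≡signed-residue H (b * + k)) ⟩
    a * (s * + r)                                                ≡⟨ swap a s (+ r) ⟩
    s * (a * + r)                                                ≈⟨ *-≡modˡ s (≡signed-residue H (a * + r)) ⟩
    s * (residueSign H (a * + r) * + absResidue H (a * + r))     ≡⟨ ℤP.*-assoc s _ _ ⟨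
    (s * residueSign H (a * + r)) * + absResidue H (a * + r)     ∎

gaussSign-* : ∀ H a b → Coprime (+ odd H) a → Coprime (+ odd H) b →
              gaussSign H (a * b) ≡ gaussSign H a * gaussSign H b
gaussSign-* H a b odd⊥a odd⊥b = begin
  gaussSign H (a * b)
    ≡⟨ ∏-cong H (residueSign-* H a b odd⊥a odd⊥b) ⟩
  ∏[1‥ H ] (λ k → sᵇ k * residueSign H (a * + rᵇ k))
    ≡⟨ ∏-distrib H sᵇ (λ k → residueSign H (a * + rᵇ k)) ⟩
  gaussSign H b * ∏[1‥ H ] (λ k → residueSign H (a * + rᵇ k))
    ≡⟨ cong (gaussSign H b *_) (∏-permute-by-residues H b odd⊥b (λ r → residueSign H (a * + r))) ⟩
  gaussSign H b * gaussSign H a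
    ≡⟨ ℤP.*-comm (gaussSign H b) (gaussSign H a) ⟩
  gaussSign H a * gaussSign H b
    ∎
  where
  open ≡-Reasoning
  sᵇ = λ k → residueSign H (b * + k)
  rᵇ = λ k → absResidue H (b * + k)

gaussSign-square : ∀ H x → Coprime (+ odd H) x → gaussSign H (x * x) ≡ 1ℤ
gaussSign-square H x odd⊥x = trans (gaussSign-* H x x odd⊥x odd⊥x) (sign-square (gaussSign-sign H x))

gauss-product : ∀ H a → Coprime (+ odd H) a →
                a ^ H * ∏[1‥ H ] (λ k → + k) ≡ gaussSign H a * ∏[1‥ H ] (λ k → + k) [mod odd H ]
gauss-product H a odd⊥a = begin
  a ^ H * ∏[1‥ H ] (λ k → + k)
    ≡⟨ cong (_* ∏[1‥ H ] (λ k → + k)) (∏-const H a) ⟨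
  ∏[1‥ H ] (λ _ → a) * ∏[1‥ H ] (λ k → + k)
    ≡⟨ ∏-distrib H (λ _ → a) (λ k → + k) ⟨
  ∏[1‥ H ] (λ k → a * + k)
    ≈⟨ ∏-≡mod H (λ k _ → ≡signed-residue H (a * + k)) ⟩
  ∏[1‥ H ] (λ k → residueSign H (a * + k) * + absResidue H (a * + k))
    ≡⟨ ∏-distrib H (λ k → residueSign H (a * + k)) (λ k → + absResidue H (a * + k)) ⟩
  gaussSign H a * ∏[1‥ H ] (λ k → + absResidue H (a * + k))
    ≡⟨ cong (gaussSign H a *_) (∏-permute-by-residues H a odd⊥a (λ k → + k)) ⟩
  gaussSign H a * ∏[1‥ H ] (λ k → + k)
    ∎
  where open ≡mod-Reasoning (odd H)

gaussSign-minus-one : ∀ H → gaussSign H -1ℤ ≡ -1ℤ ^ H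
gaussSign-minus-one H = trans (∏-cong H (λ k k∈ → sign-of-negative k k∈)) (∏-const H -1ℤ)
  where
  sign-of-negative : ∀ k → k ∈[1‥ H ] → residueSign H (-1ℤ * + k) ≡ -1ℤ
  sign-of-negative k (1≤k , k≤H) = trans (cong (foldSign H) residue≡) (foldSign-> H<odd-k)
    where
    k≤odd = ℕP.<⇒≤ (≤H⇒<odd k≤H)
    -k≡odd-k : -1ℤ * + k ≡ + (odd H ℕ.∸ k) [mod odd H ]
    -k≡odd-k = mk≡mod (divides -1ℤ (begin
      -1ℤ * + k - + (odd H ℕ.∸ k)      ≡⟨ rearrange (+ k) (+ (odd H ℕ.∸ k)) ⟩
      -1ℤ * (+ (odd H ℕ.∸ k) + + k)    ≡⟨ cong (-1ℤ *_) (ℤP.pos-+ (odd H ℕ.∸ k) k) ⟨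
      -1ℤ * + (odd H ℕ.∸ k ℕ.+ k)      ≡⟨ cong (λ n → -1ℤ * + n) (ℕP.m∸n+n≡m k≤odd) ⟩
      -1ℤ * + odd H                    ∎))
      where
      open ≡-Reasoning
      rearrange : ∀ x y → -1ℤ * x - y ≡ -1ℤ * (y + x)
      rearrange = solve-∀
    residue≡ : (-1ℤ * + k) %ℕ odd H ≡ odd H ℕ.∸ k
    residue≡ = ≡mod⇒≡ (n%ℕd<d (-1ℤ * + k) (odd H)) (ℕP.∸-monoʳ-< 1≤k k≤odd)
                     (≡mod-trans (≡mod-sym (%ℕ-≡mod (-1ℤ * + k) (odd H))) -k≡odd-k)
    H<odd-k : H < odd H ℕ.∸ k
    H<odd-k = subst (_≤ odd H ℕ.∸ k) (odd∸H H) (ℕP.∸-monoʳ-≤ (odd H) k≤H)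

gaussSign-negate : ∀ H a → Coprime (+ odd H) a → gaussSign H (- a) ≡ -1ℤ ^ H * gaussSign H a
gaussSign-negate H a odd⊥a = begin
  gaussSign H (- a)                  ≡⟨ cong (gaussSign H) (ℤP.-1*i≡-i a) ⟨
  gaussSign H (-1ℤ * a)              ≡⟨ gaussSign-* H -1ℤ a (ℕD.∣1⇒≡1 ∘ proj₂) odd⊥a ⟩
  gaussSign H -1ℤ * gaussSign H a    ≡⟨ cong (_* gaussSign H a) (gaussSign-minus-one H) ⟩
  -1ℤ ^ H * gaussSign H a            ∎
  where open ≡-Reasoning

gaussSign-two : ∀ s → gaussSign (odd s) (+ 2) ≡ -1ℤ ^ suc s
gaussSign-two s = begin
  gaussSign H (+ 2)
    ≡⟨ cong (λ n → ∏[1‥ n ] ε) H≡s+[1+s] ⟩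
  ∏[1‥ s ℕ.+ suc s ] ε
    ≡⟨ ∏-split s (suc s) ε ⟩
  ∏[1‥ s ] ε * ∏[1‥ suc s ] (λ k → ε (s ℕ.+ k))
    ≡⟨ cong₂ _*_ (∏-cong s low) (∏-cong (suc s) high) ⟩
  ∏[1‥ s ] (λ _ → 1ℤ) * ∏[1‥ suc s ] (λ _ → -1ℤ)
    ≡⟨ cong₂ _*_ (trans (∏-const s 1ℤ) (ℤP.^-zeroˡ s)) (∏-const (suc s) -1ℤ) ⟩
  1ℤ * -1ℤ ^ suc s
    ≡⟨ ℤP.*-identityˡ _ ⟩
  -1ℤ ^ suc s
    ∎
  where
  open ≡-Reasoning
  H = odd s
  ε = λ k → residueSign H (+ 2 * + k)
  H≡s+[1+s] : H ≡ s ℕ.+ suc s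
  H≡s+[1+s] = split s
    where
    split : ∀ s → suc (2 ℕ.* s) ≡ s ℕ.+ suc s
    split = ℕSolver.solve-∀
  residue≡ : ∀ k → k ≤ H → (+ 2 * + k) %ℕ odd H ≡ 2 ℕ.* k
  residue≡ k k≤H = trans (cong (_%ℕ odd H) (sym (ℤP.pos-* 2 k)))
                         (m<n⇒m%n≡m (subst (_< odd H) (cong (k ℕ.+_) (sym (ℕP.+-identityʳ k))) (x+y<odd k≤H k≤H)))
  low : ∀ k → k ∈[1‥ s ] → ε k ≡ 1ℤ
  low k (_ , k≤s) = trans (cong (foldSign H) (residue≡ k (ℕP.≤-trans k≤s s≤H)))
                          (foldSign-≤ (ℕP.m≤n⇒m≤1+n (ℕP.*-monoʳ-≤ 2 k≤s)))
    where
    s≤H = ℕP.≤-trans (ℕP.m≤m+n s (s ℕ.+ 0)) (ℕP.n≤1+n _)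
  high : ∀ k → k ∈[1‥ suc s ] → ε (s ℕ.+ k) ≡ -1ℤ
  high k (1≤k , k≤1+s) = trans (cong (foldSign H) (residue≡ (s ℕ.+ k) s+k≤H)) (foldSign-> H<2[s+k])
    where
    s+k≤H = subst (s ℕ.+ k ≤_) (sym H≡s+[1+s]) (ℕP.+-monoʳ-≤ s k≤1+s)
    two-more : ∀ s → 2 ℕ.* (s ℕ.+ 1) ≡ suc (suc (2 ℕ.* s))
    two-more = ℕSolver.solve-∀
    H<2[s+k] : H < 2 ℕ.* (s ℕ.+ k)
    H<2[s+k] = subst (_≤ 2 ℕ.* (s ℕ.+ k)) (two-more s) (ℕP.*-monoʳ-≤ 2 (ℕP.+-monoʳ-≤ s 1≤k))

-- Prime moduli

prime∣*⇒∣⊎∣ : ∀ {p} → Prime p → ∀ x y → + p ∣ x * y → (+ p ∣ x) ⊎ (+ p ∣ y)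
prime∣*⇒∣⊎∣ {p} p-prime x y p∣xy =
  Sum.map ∣ᵤ⇒∣ ∣ᵤ⇒∣ (euclidsLemma ∣ x ∣ ∣ y ∣ p-prime (subst (p ℕD.∣_) (ℤP.abs-* x y) (∣⇒∣ᵤ p∣xy)))

prime∤⇒coprime : ∀ {p a} → Prime p → ¬ (+ p ∣ a) → Coprime (+ p) a
prime∤⇒coprime {p} p-prime p∤a (d∣p , d∣a) with prime⇒irreducible p-prime d∣p
... | inj₁ d≡1 = d≡1
... | inj₂ refl = ⊥-elim (p∤a (∣ᵤ⇒∣ d∣a))

prime>1 : ∀ {p} → Prime p → 1 < p
prime>1 {p} p-prime = ℕ.nonTrivial⇒n>1 p {{prime⇒nonTrivial p-prime}}

prime∤∏ : ∀ {p} → Prime p → ∀ n {f : ℕ → ℤ} → (∀ k → k ∈[1‥ n ] → ¬ (+ p ∣ f k)) → ¬ (+ p ∣ ∏[1‥ n ] f)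
prime∤∏ p-prime zero    p∤f = 0<x<M⇒M∤x ℕP.≤-refl (prime>1 p-prime)
prime∤∏ p-prime (suc n) {f} p∤f p∣∏ with prime∣*⇒∣⊎∣ p-prime (f 1) _ p∣∏
... | inj₁ p∣f1 = p∤f 1 (ℕP.≤-refl , s≤s z≤n) p∣f1
... | inj₂ p∣∏′ = prime∤∏ p-prime n (λ k (1≤k , k≤n) → p∤f (suc k) (s≤s z≤n , s≤s k≤n)) p∣∏′

euler-criterion : ∀ H a → Prime (odd H) → Coprime (+ odd H) a → a ^ H ≡ gaussSign H a [mod odd H ]
euler-criterion H a p-prime p⊥a = mk≡mod (coprime-cancel F (a ^ H - gaussSign H a)
  (prime∤⇒coprime p-prime (prime∤∏ p-prime H (λ k → odd∤[1‥H])))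
  (subst (+ odd H ∣_) (factor (a ^ H) (gaussSign H a) F) (M∣a-b (gauss-product H a p⊥a))))
  where
  F = ∏[1‥ H ] (λ k → + k)
  factor : ∀ x s f → x * f - s * f ≡ f * (x - s)
  factor = solve-∀

-- monic cs x = c₀ + c₁x + ⋯ + cₙ₋₁xⁿ⁻¹ + xⁿ: the leading coefficient 1 is implicit.
monic : ∀ {n} → Vec ℤ n → ℤ → ℤ
monic []       x = 1ℤ
monic (c ∷ cs) x = c + x * monic cs x

quotient : ∀ {n} → Vec ℤ n → ℤ → Vec ℤ n
quotient []       r = []
quotient (c ∷ cs) r = monic (c ∷ cs) r ∷ quotient cs r

monic-factor : ∀ {n} c (cs : Vec ℤ n) x r → monic (c ∷ cs) x - monic (c ∷ cs) r ≡ (x - r) * monic (quotient cs r) x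
monic-factor c []        x r = linear c x r
  where
  linear : ∀ c x r → (c + x * 1ℤ) - (c + r * 1ℤ) ≡ (x - r) * 1ℤ
  linear = solve-∀
monic-factor c (c′ ∷ cs) x r = begin
  (c + x * T x) - (c + r * T r)             ≡⟨ regroup c x r (T x) (T r) ⟩
  x * (T x - T r) + (x - r) * T r           ≡⟨ cong (λ d → x * d + (x - r) * T r) (monic-factor c′ cs x r) ⟩
  x * ((x - r) * Q x) + (x - r) * T r       ≡⟨ collect x r (Q x) (T r) ⟩
  (x - r) * (T r + x * Q x)                 ∎
  where
  open ≡-Reasoning
  T = monic (c′ ∷ cs)
  Q = monic (quotient cs r)
  regroup : ∀ c x r tx tr → (c + x * tx) - (c + r * tr) ≡ x * (tx - tr) + (x - r) * tr
  regroup = solve-∀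
  collect : ∀ x r q tr → x * ((x - r) * q) + (x - r) * tr ≡ (x - r) * (tr + x * q)
  collect = solve-∀

lagrange : ∀ {p} → Prime p → ∀ {n} (cs : Vec ℤ n) (r : ℕ → ℤ) →
           (∀ i → i ≤ n → + p ∣ monic cs (r i)) →
           ¬ (∀ i j → i < j → j ≤ n → ¬ (+ p ∣ r j - r i))
lagrange p-prime []       r roots distinct = 0<x<M⇒M∤x ℕP.≤-refl (prime>1 p-prime) (roots 0 z≤n)
lagrange p-prime (c ∷ cs) r roots distinct =
  lagrange p-prime (quotient cs (r 0)) (r ∘ suc) roots′ (λ i j i<j j≤n → distinct (suc i) (suc j) (s≤s i<j) (s≤s j≤n))
  where
  roots′ : ∀ i → i ≤ _ → + _ ∣ monic (quotient cs (r 0)) (r (suc i))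
  roots′ i i≤n with prime∣*⇒∣⊎∣ p-prime _ _
         (subst (_ ∣_) (monic-factor c cs (r (suc i)) (r 0)) (∣m∣n⇒∣m-n (roots (suc i) (s≤s i≤n)) (roots 0 z≤n)))
  ... | inj₁ p∣ri-r0 = ⊥-elim (distinct 0 (suc i) (s≤s z≤n) (s≤s i≤n) p∣ri-r0)
  ... | inj₂ p∣q     = p∣q

monic-zeros : ∀ n x → monic (replicate n 0ℤ) x ≡ x ^ n
monic-zeros zero    x = refl
monic-zeros (suc n) x = trans (ℤP.+-identityˡ _) (cong (x *_) (monic-zeros n x))

xⁿ-1 : ∀ n → Vec ℤ (suc n)
xⁿ-1 n = -1ℤ ∷ replicate n 0ℤ

monic-xⁿ-1 : ∀ n y → monic (xⁿ-1 n) y ≡ y ^ suc n - 1ℤ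
monic-xⁿ-1 n y = trans (cong (λ z → -1ℤ + y * z) (monic-zeros n y)) (ℤP.+-comm -1ℤ (y ^ suc n))

square⇒gaussSign≡1 : ∀ H a → Prime (odd H) → ¬ (+ odd H ∣ a) → IsSquareMod a (odd H) → gaussSign H a ≡ 1ℤ
square⇒gaussSign≡1 H a p-prime p∤a (x , p∣x²-a) =
  trans (gaussSign-cong H (≡mod-sym (mk≡mod {X * X} {a} p∣x²-a))) (gaussSign-square H X (prime∤⇒coprime p-prime p∤X))
  where
  X = + toℕ x
  cancel : ∀ u v → u - (u - v) ≡ v
  cancel = solve-∀
  p∤X : ¬ (+ odd H ∣ X)
  p∤X p∣X = p∤a (subst (+ odd H ∣_) (cancel (X * X) a) (∣m∣n⇒∣m-n (∣m⇒∣m*n X p∣X) p∣x²-a))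

-- If gaussSign H a were 1, Euler's criterion would make a, 1², …, H² pairwise
-- incongruent roots of x^H − 1 modulo the prime 2H + 1.
nonsquare⇒gaussSign≡-1 : ∀ H a → Prime (odd H) → ¬ (+ odd H ∣ a) → ¬ IsSquareMod a (odd H) → gaussSign H a ≡ -1ℤ
nonsquare⇒gaussSign≡-1 zero    a p-prime _ _ = ⊥-elim (ℕP.<-irrefl refl (prime>1 p-prime))
nonsquare⇒gaussSign≡-1 (suc H) a p-prime p∤a nonsquare with gaussSign-sign (suc H) a
... | inj₂ σ≡-1 = σ≡-1
... | inj₁ σ≡1  = ⊥-elim (lagrange p-prime (xⁿ-1 H) r roots distinct)
  where
  p = odd (suc H)
  difference-of-squares : ∀ x y → x * x - y * y ≡ (x - y) * (x + y)
  difference-of-squares = solve-∀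
  r : ℕ → ℤ
  r zero    = a
  r (suc i) = + suc i * + suc i
  root : ∀ y → y ^ suc H ≡ 1ℤ [mod p ] → + p ∣ monic (xⁿ-1 H) y
  root y (mk≡mod p∣yᴴ-1) = subst (+ p ∣_) (sym (monic-xⁿ-1 H y)) p∣yᴴ-1
  roots : ∀ i → i ≤ suc H → + p ∣ monic (xⁿ-1 H) (r i)
  roots zero    _   = root a (≡mod-trans (euler-criterion (suc H) a p-prime (prime∤⇒coprime p-prime p∤a)) (≡⇒≡mod σ≡1))
  roots (suc i) i<H = root (k * k) (≡mod-trans (euler-criterion (suc H) (k * k) p-prime p⊥k²) (≡⇒≡mod (gaussSign-square (suc H) k p⊥k)))
    where
    k = + suc i
    p∤k = odd∤[1‥H] (s≤s z≤n , i<H)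
    p⊥k = prime∤⇒coprime p-prime p∤k
    p⊥k² = prime∤⇒coprime p-prime (λ p∣k² → [ p∤k , p∤k ]′ (prime∣*⇒∣⊎∣ p-prime k k p∣k²))
  distinct : ∀ i j → i < j → j ≤ suc H → ¬ (+ p ∣ r j - r i)
  distinct zero    (suc j) _   j<H p∣k²-a = nonsquare (fromℕ< k<p , subst (λ k → + p ∣ + k * + k - a) (sym (toℕ-fromℕ< k<p)) p∣k²-a)
    where
    k<p = ≤H⇒<odd j<H
  distinct (suc i) (suc j) i<j j<H p∣k²-l² with prime∣*⇒∣⊎∣ p-prime (+ suc j - + suc i) (+ suc j + + suc i)
         (subst (+ p ∣_) (difference-of-squares (+ suc j) (+ suc i)) p∣k²-l²)
  ... | inj₁ p∣k-l = ℕP.<⇒≢ i<j (sym (≡mod⇒≡ (≤H⇒<odd j<H) (≤H⇒<odd i≤H) (mk≡mod {+ suc j} {+ suc i} p∣k-l)))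
    where i≤H = ℕP.<⇒≤ (ℕP.<-≤-trans i<j j<H)
  ... | inj₂ p∣k+l = odd∤x+y (s≤s z≤n) j<H (ℕP.<⇒≤ (ℕP.<-≤-trans i<j j<H)) p∣k+l

legendre≡gaussSign : ∀ H a → Prime (odd H) → ¬ (+ odd H ∣ a) → legendre a (odd H) ≡ gaussSign H a
legendre≡gaussSign H a p-prime p∤a with + odd H ∣?ℤ a
... | yes p∣a = ⊥-elim (p∤a p∣a)
... | no  _ with isSquareMod? a (odd H)
...   | yes square    = sym (square⇒gaussSign≡1 H a p-prime p∤a square)
...   | no  nonsquare = sym (nonsquare⇒gaussSign≡-1 H a p-prime p∤a nonsquare)

-- Reciprocity

-1^-fold : ∀ H r → r < odd H → -1ℤ ^ r ≡ foldSign H r * -1ℤ ^ foldAbs H r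
-1^-fold H r r<odd with r ℕ.≤? H
... | yes _ = sym (ℤP.*-identityˡ _)
... | no  _ = begin
  -1ℤ ^ r                             ≡⟨ sign-cancelˡ (-1^-sign (odd H ℕ.∸ r)) _ ⟨
  s * (s * -1ℤ ^ r)                   ≡⟨ cong (s *_) (ℤP.^-distribˡ-+-* -1ℤ (odd H ℕ.∸ r) r) ⟨
  s * -1ℤ ^ (odd H ℕ.∸ r ℕ.+ r)       ≡⟨ cong (λ e → s * -1ℤ ^ e) (ℕP.m∸n+n≡m (ℕP.<⇒≤ r<odd)) ⟩
  s * -1ℤ ^ odd H                     ≡⟨ cong (s *_) (-1^-odd H) ⟩
  s * -1ℤ                             ≡⟨ ℤP.*-comm s -1ℤ ⟩
  -1ℤ * s                             ∎
  where
  open ≡-Reasoning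
  s = -1ℤ ^ (odd H ℕ.∸ r)

-- Write k·(2A+1) = q_k·(2H+1) + r_k with r_k ≡ ε_k·ρ_k, where ε_k = ±1 and ρ_k ≤ H.  Parity gives
-- (−1)^k = ε_k (−1)^ρ_k (−1)^q_k; multiply over k and cancel ∏ (−1)^k, which k ↦ ρ_k permutes.
eisenstein : ∀ H A → Coprime (+ odd H) (+ odd A) →
             gaussSign H (+ odd A) ≡ -1ℤ ^ ∑[1‥ H ] (λ k → (k ℕ.* odd A) / odd H)
eisenstein H A odd⊥a = sign-cancel (∏-sign H -1^-sign) (gaussSign-sign H a) (-1^-sign (∑[1‥ H ] q)) product
  where
  open ≡-Reasoning
  a = + odd A
  σ = gaussSign H a
  ε = λ k → residueSign H (a * + k)
  ρ = λ k → absResidue H (a * + k)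
  q = λ k → (k ℕ.* odd A) / odd H
  r = λ k → (k ℕ.* odd A) % odd H
  residue≡ : ∀ k → (a * + k) %ℕ odd H ≡ r k
  residue≡ k = cong (_%ℕ odd H) (trans (sym (ℤP.pos-* (odd A) k)) (cong +_ (ℕP.*-comm (odd A) k)))
  -1^k-split : ∀ k → -1ℤ ^ k ≡ ε k * (-1ℤ ^ ρ k * -1ℤ ^ q k)
  -1^k-split k = begin
    -1ℤ ^ k                                       ≡⟨ -1^-*odd k A ⟨
    -1ℤ ^ (k ℕ.* odd A)                           ≡⟨ cong (-1ℤ ^_) (m≡m%n+[m/n]*n (k ℕ.* odd A) (odd H)) ⟩
    -1ℤ ^ (r k ℕ.+ q k ℕ.* odd H)                 ≡⟨ ℤP.^-distribˡ-+-* -1ℤ (r k) _ ⟩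
    -1ℤ ^ r k * -1ℤ ^ (q k ℕ.* odd H)             ≡⟨ cong₂ _*_ (-1^-fold H (r k) (m%n<n (k ℕ.* odd A) (odd H))) (-1^-*odd (q k) H) ⟩
    (foldSign H (r k) * -1ℤ ^ foldAbs H (r k)) * -1ℤ ^ q k
                                                  ≡⟨ ℤP.*-assoc (foldSign H (r k)) _ _ ⟩
    foldSign H (r k) * (-1ℤ ^ foldAbs H (r k) * -1ℤ ^ q k)
                                                  ≡⟨ cong (λ x → foldSign H x * (-1ℤ ^ foldAbs H x * -1ℤ ^ q k)) (residue≡ k) ⟨
    ε k * (-1ℤ ^ ρ k * -1ℤ ^ q k)                 ∎
  product : ∏[1‥ H ] (-1ℤ ^_) ≡ σ * (∏[1‥ H ] (-1ℤ ^_) * -1ℤ ^ ∑[1‥ H ] q)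
  product = begin
    ∏[1‥ H ] (-1ℤ ^_)
      ≡⟨ ∏-cong H (λ k _ → -1^k-split k) ⟩
    ∏[1‥ H ] (λ k → ε k * (-1ℤ ^ ρ k * -1ℤ ^ q k))
      ≡⟨ ∏-distrib H ε (λ k → -1ℤ ^ ρ k * -1ℤ ^ q k) ⟩
    σ * ∏[1‥ H ] (λ k → -1ℤ ^ ρ k * -1ℤ ^ q k)
      ≡⟨ cong (σ *_) (∏-distrib H (λ k → -1ℤ ^ ρ k) (λ k → -1ℤ ^ q k)) ⟩
    σ * (∏[1‥ H ] (λ k → -1ℤ ^ ρ k) * ∏[1‥ H ] (λ k → -1ℤ ^ q k))
      ≡⟨ cong₂ (λ u v → σ * (u * v)) (∏-permute-by-residues H a odd⊥a (-1ℤ ^_)) (∏-^ -1ℤ H q) ⟩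
    σ * (∏[1‥ H ] (-1ℤ ^_) * -1ℤ ^ ∑[1‥ H ] q)
      ∎

[_≤_] : ℕ → ℕ → ℕ
[ zero  ≤ _     ] = 1
[ suc _ ≤ zero  ] = 0
[ suc m ≤ suc n ] = [ m ≤ n ]

[≤]-true : ∀ {m n} → m ≤ n → [ m ≤ n ] ≡ 1
[≤]-true {zero}  _         = refl
[≤]-true {suc m} (s≤s m≤n) = [≤]-true m≤n

[≤]-false : ∀ {m n} → ¬ m ≤ n → [ m ≤ n ] ≡ 0
[≤]-false {zero}          m≰n = ⊥-elim (m≰n z≤n)
[≤]-false {suc m} {zero}  _   = refl
[≤]-false {suc m} {suc n} m≰n = [≤]-false (m≰n ∘ s≤s)

[≤]-cong : ∀ {m n m′ n′} → (m ≤ n → m′ ≤ n′) → (m′ ≤ n′ → m ≤ n) → [ m ≤ n ] ≡ [ m′ ≤ n′ ]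
[≤]-cong {m} {n} to from with m ℕ.≤? n
... | yes m≤n = trans ([≤]-true m≤n) (sym ([≤]-true (to m≤n)))
... | no  m≰n = trans ([≤]-false m≰n) (sym ([≤]-false (m≰n ∘ from)))

[≤]+[≥] : ∀ {m n} → m ≢ n → [ m ≤ n ] ℕ.+ [ n ≤ m ] ≡ 1
[≤]+[≥] {zero}  {zero}  m≢n = ⊥-elim (m≢n refl)
[≤]+[≥] {zero}  {suc n} _   = refl
[≤]+[≥] {suc m} {zero}  _   = refl
[≤]+[≥] {suc m} {suc n} m≢n = [≤]+[≥] (m≢n ∘ cong suc)

∑-[≤] : ∀ A t → ∑[1‥ A ] (λ l → [ l ≤ t ]) ≡ A ⊓ t
∑-[≤] zero    t       = refl
∑-[≤] (suc A) zero    = ∑ℕ.sum-replicate-zero A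
∑-[≤] (suc A) (suc t) = cong suc (∑-[≤] A t)

/-as-count : ∀ {M} .{{_ : ℕ.NonZero M}} x A → x < suc A ℕ.* M → x / M ≡ ∑[1‥ A ] (λ l → [ l ℕ.* M ≤ x ])
/-as-count {M} x A x<[1+A]M = sym (begin
  ∑[1‥ A ] (λ l → [ l ℕ.* M ≤ x ])  ≡⟨ ∑-cong A (λ l _ → [≤]-cong (*≤⇒≤/ l) (≤/⇒*≤ l)) ⟩
  ∑[1‥ A ] (λ l → [ l ≤ x / M ])    ≡⟨ ∑-[≤] A (x / M) ⟩
  A ⊓ (x / M)                       ≡⟨ ℕP.m≥n⇒m⊓n≡n (ℕP.≤-pred (m<n*o⇒m/o<n x<[1+A]M)) ⟩
  x / M                             ∎)
  where
  open ≡-Reasoning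
  *≤⇒≤/ : ∀ l → l ℕ.* M ≤ x → l ≤ x / M
  *≤⇒≤/ l lM≤x = subst (_≤ x / M) (m*n/n≡m l M) (/-monoˡ-≤ M lM≤x)
  ≤/⇒*≤ : ∀ l → l ≤ x / M → l ℕ.* M ≤ x
  ≤/⇒*≤ l l≤x/M = ℕP.≤-trans (ℕP.*-monoˡ-≤ M l≤x/M) (m/n*n≤m x M)

k≤H⇒k*oddA<[1+A]*oddH : ∀ {H A k} → k ≤ H → k ℕ.* odd A < suc A ℕ.* odd H
k≤H⇒k*oddA<[1+A]*oddH {H} {A} {k} k≤H = begin-strict
  k ℕ.* odd A                       ≤⟨ ℕP.*-monoˡ-≤ (odd A) k≤H ⟩
  H ℕ.* odd A                       <⟨ ℕP.m<m+n (H ℕ.* odd A) (s≤s z≤n) ⟩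
  H ℕ.* odd A ℕ.+ suc (H ℕ.+ A)     ≡⟨ identity H A ⟨
  suc A ℕ.* odd H                   ∎
  where
  open ℕP.≤-Reasoning
  identity : ∀ H A → suc A ℕ.* suc (2 ℕ.* H) ≡ H ℕ.* suc (2 ℕ.* A) ℕ.+ suc (H ℕ.+ A)
  identity = ℕSolver.solve-∀

-- Each lattice point (k, l) of [1, H] × [1, A] lies strictly below or strictly above the
-- line l·(2H+1) = k·(2A+1), since the moduli are coprime.
lattice-count : ∀ H A → Coprime (+ odd H) (+ odd A) →
                ∑[1‥ H ] (λ k → (k ℕ.* odd A) / odd H) ℕ.+ ∑[1‥ A ] (λ l → (l ℕ.* odd H) / odd A) ≡ H ℕ.* A
lattice-count H A odd⊥a = begin
  ∑[1‥ H ] (λ k → (k ℕ.* odd A) / odd H) ℕ.+ ∑[1‥ A ] (λ l → (l ℕ.* odd H) / odd A)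
    ≡⟨ cong₂ ℕ._+_ (∑-cong H (λ k (_ , k≤H) → /-as-count (k ℕ.* odd A) A (k≤H⇒k*oddA<[1+A]*oddH {A = A} k≤H)))
                   (∑-cong A (λ l (_ , l≤A) → /-as-count (l ℕ.* odd H) H (k≤H⇒k*oddA<[1+A]*oddH {A = H} l≤A))) ⟩
  ∑[1‥ H ] (λ k → ∑[1‥ A ] (below k)) ℕ.+ ∑[1‥ A ] (λ l → ∑[1‥ H ] (λ k → above k l))
    ≡⟨ cong (∑[1‥ H ] (λ k → ∑[1‥ A ] (below k)) ℕ.+_) (∑-comm A H (λ l k → above k l)) ⟩
  ∑[1‥ H ] (λ k → ∑[1‥ A ] (below k)) ℕ.+ ∑[1‥ H ] (λ k → ∑[1‥ A ] (above k))
    ≡⟨ ∑-distrib H (λ k → ∑[1‥ A ] (below k)) (λ k → ∑[1‥ A ] (above k)) ⟨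
  ∑[1‥ H ] (λ k → ∑[1‥ A ] (below k) ℕ.+ ∑[1‥ A ] (above k))
    ≡⟨ ∑-cong H (λ k k∈ → trans (sym (∑-distrib A (below k) (above k)))
                                (∑-cong A (λ l l∈ → [≤]+[≥] (distinct k l k∈ l∈)))) ⟩
  ∑[1‥ H ] (λ _ → ∑[1‥ A ] (λ _ → 1))
    ≡⟨ ∑-cong H (λ _ _ → trans (∑-const A 1) (ℕP.*-identityʳ A)) ⟩
  ∑[1‥ H ] (λ _ → A)
    ≡⟨ ∑-const H A ⟩
  H ℕ.* A ∎
  where
  open ≡-Reasoning
  below above : ℕ → ℕ → ℕ
  below k l = [ l ℕ.* odd H ≤ k ℕ.* odd A ]
  above k l = [ k ℕ.* odd A ≤ l ℕ.* odd H ]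
  distinct : ∀ k l → k ∈[1‥ H ] → l ∈[1‥ A ] → l ℕ.* odd H ≢ k ℕ.* odd A
  distinct k l k∈ _ eq = odd∤[1‥H] k∈ (coprime-cancel (+ odd A) (+ k) odd⊥a (divides (+ l) (begin
    + odd A * + k        ≡⟨ ℤP.pos-* (odd A) k ⟨
    + (odd A ℕ.* k)      ≡⟨ cong +_ (ℕP.*-comm (odd A) k) ⟩
    + (k ℕ.* odd A)      ≡⟨ cong +_ eq ⟨
    + (l ℕ.* odd H)      ≡⟨ ℤP.pos-* l (odd H) ⟩
    + l * + odd H        ∎)))

reciprocity : ∀ H A → Coprime (+ odd H) (+ odd A) →
              gaussSign H (+ odd A) * gaussSign A (+ odd H) ≡ -1ℤ ^ (H ℕ.* A)
reciprocity H A odd⊥odd = begin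
  gaussSign H (+ odd A) * gaussSign A (+ odd H)
    ≡⟨ cong₂ _*_ (eisenstein H A odd⊥odd) (eisenstein A H (ℤC.sym {+ odd H} {+ odd A} odd⊥odd)) ⟩
  -1ℤ ^ Σ₁ * -1ℤ ^ Σ₂    ≡⟨ ℤP.^-distribˡ-+-* -1ℤ Σ₁ Σ₂ ⟨
  -1ℤ ^ (Σ₁ ℕ.+ Σ₂)       ≡⟨ cong (-1ℤ ^_) (lattice-count H A odd⊥odd) ⟩
  -1ℤ ^ (H ℕ.* A)         ∎
  where
  open ≡-Reasoning
  Σ₁ = ∑[1‥ H ] (λ k → (k ℕ.* odd A) / odd H)
  Σ₂ = ∑[1‥ A ] (λ l → (l ℕ.* odd H) / odd A)

gaussSign-flip : ∀ H A → Coprime (+ odd H) (+ odd A) →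
                 gaussSign H (+ odd A) ≡ gaussSign A (+ odd H) * -1ℤ ^ (H ℕ.* A)
gaussSign-flip H A odd⊥odd = sign-transpose (gaussSign-sign A (+ odd H)) (reciprocity H A odd⊥odd)

-- Composite moduli

_⊛_ : ℕ → ℕ → ℕ
H₁ ⊛ H₂ = 2 ℕ.* H₁ ℕ.* H₂ ℕ.+ (H₁ ℕ.+ H₂)

odd-⊛ : ∀ H₁ H₂ → odd (H₁ ⊛ H₂) ≡ odd H₁ ℕ.* odd H₂
odd-⊛ H₁ H₂ = expand H₁ H₂
  where
  expand : ∀ H₁ H₂ → suc (2 ℕ.* (2 ℕ.* H₁ ℕ.* H₂ ℕ.+ (H₁ ℕ.+ H₂))) ≡ suc (2 ℕ.* H₁) ℕ.* suc (2 ℕ.* H₂)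
  expand = ℕSolver.solve-∀

-1^-⊛ : ∀ H₁ H₂ A → -1ℤ ^ ((H₁ ⊛ H₂) ℕ.* A) ≡ -1ℤ ^ (H₁ ℕ.* A) * -1ℤ ^ (H₂ ℕ.* A)
-1^-⊛ H₁ H₂ A = begin
  -1ℤ ^ ((H₁ ⊛ H₂) ℕ.* A)
    ≡⟨ cong (-1ℤ ^_) (expand H₁ H₂ A) ⟩
  -1ℤ ^ (2 ℕ.* (H₁ ℕ.* H₂ ℕ.* A) ℕ.+ (H₁ ℕ.* A ℕ.+ H₂ ℕ.* A))
    ≡⟨ ℤP.^-distribˡ-+-* -1ℤ (2 ℕ.* (H₁ ℕ.* H₂ ℕ.* A)) (H₁ ℕ.* A ℕ.+ H₂ ℕ.* A) ⟩
  -1ℤ ^ (2 ℕ.* (H₁ ℕ.* H₂ ℕ.* A)) * -1ℤ ^ (H₁ ℕ.* A ℕ.+ H₂ ℕ.* A)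
    ≡⟨ cong (_* -1ℤ ^ (H₁ ℕ.* A ℕ.+ H₂ ℕ.* A)) (-1^-even (H₁ ℕ.* H₂ ℕ.* A)) ⟩
  1ℤ * -1ℤ ^ (H₁ ℕ.* A ℕ.+ H₂ ℕ.* A)
    ≡⟨ ℤP.*-identityˡ _ ⟩
  -1ℤ ^ (H₁ ℕ.* A ℕ.+ H₂ ℕ.* A)
    ≡⟨ ℤP.^-distribˡ-+-* -1ℤ (H₁ ℕ.* A) (H₂ ℕ.* A) ⟩
  -1ℤ ^ (H₁ ℕ.* A) * -1ℤ ^ (H₂ ℕ.* A)
    ∎
  where
  open ≡-Reasoning
  expand : ∀ H₁ H₂ A → (2 ℕ.* H₁ ℕ.* H₂ ℕ.+ (H₁ ℕ.+ H₂)) ℕ.* A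
                       ≡ 2 ℕ.* (H₁ ℕ.* H₂ ℕ.* A) ℕ.+ (H₁ ℕ.* A ℕ.+ H₂ ℕ.* A)
  expand = ℕSolver.solve-∀

-- Replace a by an odd positive representative 2A+1: reciprocity moves the modulus into
-- the numerator, where the sign is multiplicative.
gaussSign-⊛ : ∀ H₁ H₂ a → Coprime (+ odd (H₁ ⊛ H₂)) a → gaussSign (H₁ ⊛ H₂) a ≡ gaussSign H₁ a * gaussSign H₂ a
gaussSign-⊛ H₁ H₂ a odd⊥a = begin
  gaussSign H a
    ≡⟨ gaussSign-cong H a≡ ⟩
  gaussSign H (+ odd A)
    ≡⟨ gaussSign-flip H A H⊥A ⟩
  gaussSign A (+ odd H) * -1ℤ ^ (H ℕ.* A)
    ≡⟨ cong₂ _*_ σ_A-split (-1^-⊛ H₁ H₂ A) ⟩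
  (σ_A H₁ * σ_A H₂) * (-1ℤ ^ (H₁ ℕ.* A) * -1ℤ ^ (H₂ ℕ.* A))
    ≡⟨ interchange (σ_A H₁) (σ_A H₂) (-1ℤ ^ (H₁ ℕ.* A)) (-1ℤ ^ (H₂ ℕ.* A)) ⟩
  (σ_A H₁ * -1ℤ ^ (H₁ ℕ.* A)) * (σ_A H₂ * -1ℤ ^ (H₂ ℕ.* A))
    ≡⟨ cong₂ _*_ (gaussSign-flip H₁ A H₁⊥A) (gaussSign-flip H₂ A H₂⊥A) ⟨
  gaussSign H₁ (+ odd A) * gaussSign H₂ (+ odd A)
    ≡⟨ cong₂ _*_ (gaussSign-cong H₁ (≡mod-∣ odd₁∣ a≡)) (gaussSign-cong H₂ (≡mod-∣ odd₂∣ a≡)) ⟨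
  gaussSign H₁ a * gaussSign H₂ a
    ∎
  where
  open ≡-Reasoning
  H = H₁ ⊛ H₂
  A = proj₁ (≡-odd-representative a H)
  a≡ : a ≡ + odd A [mod odd H ]
  a≡ = proj₂ (≡-odd-representative a H)
  odd₁∣ : odd H₁ ℕD.∣ odd H
  odd₁∣ = ℕD.divides (odd H₂) (trans (odd-⊛ H₁ H₂) (ℕP.*-comm (odd H₁) (odd H₂)))
  odd₂∣ : odd H₂ ℕD.∣ odd H
  odd₂∣ = ℕD.divides (odd H₁) (odd-⊛ H₁ H₂)
  H⊥A : Coprime (+ odd H) (+ odd A)
  H⊥A = coprime-≡mod odd⊥a a≡
  H₁⊥A : Coprime (+ odd H₁) (+ odd A)
  H₁⊥A = coprime-∣ {a = + odd A} odd₁∣ H⊥A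
  H₂⊥A : Coprime (+ odd H₂) (+ odd A)
  H₂⊥A = coprime-∣ {a = + odd A} odd₂∣ H⊥A
  σ_A : ℕ → ℤ
  σ_A Hᵢ = gaussSign A (+ odd Hᵢ)
  σ_A-split : gaussSign A (+ odd H) ≡ σ_A H₁ * σ_A H₂
  σ_A-split = trans (cong (gaussSign A) (trans (cong +_ (odd-⊛ H₁ H₂)) (ℤP.pos-* (odd H₁) (odd H₂))))
                    (gaussSign-* A (+ odd H₁) (+ odd H₂) (ℤC.sym {+ odd H₁} {+ odd A} H₁⊥A) (ℤC.sym {+ odd H₂} {+ odd A} H₂⊥A))
  interchange : ∀ w x y z → (w * x) * (y * z) ≡ (w * y) * (x * z)
  interchange = solve-∀

schering : ∀ {H a} → Coprime (+ odd H) a → JacobiIs a (odd H) (gaussSign H a)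
schering {H} {a} odd⊥a [] [] 1≡odd with odd-injective {0} {H} 1≡odd
... | refl = refl
schering {H} {a} odd⊥a (p ∷ ps) (p-prime ∷ ps-prime) pR≡odd
  with odd-factor p (foldr ℕ._*_ 1 ps) {H} pR≡odd | odd-factor (foldr ℕ._*_ 1 ps) p {H} (trans (ℕP.*-comm _ p) pR≡odd)
... | Hp , refl | HR , R≡odd = begin
  legendre a (odd Hp) * legendreProduct a ps   ≡⟨ cong₂ _*_ (legendre≡gaussSign Hp a p-prime p∤a)
                                                            (schering {HR} {a} HR⊥a ps ps-prime R≡odd) ⟩
  gaussSign Hp a * gaussSign HR a              ≡⟨ gaussSign-⊛ Hp HR a (subst (λ K → Coprime (+ odd K) a) H≡ odd⊥a) ⟨
  gaussSign (Hp ⊛ HR) a                        ≡⟨ cong (λ K → gaussSign K a) H≡ ⟨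
  gaussSign H a                                ∎
  where
  open ≡-Reasoning
  H≡ : H ≡ Hp ⊛ HR
  H≡ = odd-injective (trans (sym pR≡odd) (trans (cong (odd Hp ℕ.*_) R≡odd) (sym (odd-⊛ Hp HR))))
  HR⊥a : Coprime (+ odd HR) a
  HR⊥a = coprime-∣ {a = a} (ℕD.divides (odd Hp) (trans (sym pR≡odd) (cong (odd Hp ℕ.*_) R≡odd))) odd⊥a
  p∣odd : odd Hp ℕD.∣ odd H
  p∣odd = ℕD.divides (foldr ℕ._*_ 1 ps) (trans (sym pR≡odd) (ℕP.*-comm (odd Hp) (foldr ℕ._*_ 1 ps)))
  p∤a : ¬ (+ odd Hp ∣ a)
  p∤a p∣a = ℕP.<⇒≢ (prime>1 p-prime) (sym (odd⊥a (p∣odd , ∣⇒∣ᵤ p∣a)))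

-- Divisors of 4dn

divisor-of-suc-coprime : ∀ {M x} → x ℕD.∣ suc M → Coprime (+ M) (+ x)
divisor-of-suc-coprime {M} x∣1+M {d} (d∣M , d∣x) =
  ℕD.∣1⇒≡1 (ℕD.∣m+n∣m⇒∣n (subst (d ℕD.∣_) (ℕP.+-comm 1 M) (ℕD.∣-trans d∣x x∣1+M)) d∣M)

gaussSign-odd-divisor : ∀ K j → odd j ℕD.∣ suc (odd (odd K)) → gaussSign (odd K) (+ odd j) ≡ 1ℤ
gaussSign-odd-divisor K j j∣ = begin
  gaussSign H (+ odd j)                  ≡⟨ gaussSign-flip H j (divisor-of-suc-coprime j∣) ⟩
  gaussSign j (+ odd H) * -1ℤ ^ (H ℕ.* j) ≡⟨ cong₂ _*_ (trans (gaussSign-cong j oddH≡-1) (gaussSign-minus-one j))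
                                                        (trans (cong (-1ℤ ^_) (ℕP.*-comm H j)) (-1^-*odd j K)) ⟩
  -1ℤ ^ j * -1ℤ ^ j                       ≡⟨ sign-square (-1^-sign j) ⟩
  1ℤ                                      ∎
  where
  open ≡-Reasoning
  H = odd K
  oddH≡-1 : + odd H ≡ -1ℤ [mod odd j ]
  oddH≡-1 = mk≡mod (subst (+ odd j ∣_) (trans (cong +_ (ℕP.+-comm 1 (odd H))) (ℤP.pos-+ (odd H) 1)) (∣ᵤ⇒∣ j∣))

gaussSign-divisor-of-suc : ∀ K x → Acc _<_ x → 1 ≤ x → x ℕD.∣ suc (odd (odd K)) →
                           (2 ℕD.∣ x → gaussSign (odd K) (+ 2) ≡ 1ℤ) → gaussSign (odd K) (+ x) ≡ 1ℤ
gaussSign-divisor-of-suc K x (acc smaller) 1≤x x∣ σ₂≡1 with even⊎odd x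
... | j , inj₂ refl = gaussSign-odd-divisor K j x∣
... | j , inj₁ refl = begin
  gaussSign H (+ (2 ℕ.* j))
    ≡⟨ cong (gaussSign H) (ℤP.pos-* 2 j) ⟩
  gaussSign H (+ 2 * + j)
    ≡⟨ gaussSign-* H (+ 2) (+ j) (divisor-of-suc-coprime 2∣) (divisor-of-suc-coprime j∣) ⟩
  gaussSign H (+ 2) * gaussSign H (+ j)
    ≡⟨ cong₂ _*_ σ₂≡1′ (gaussSign-divisor-of-suc K j (smaller j<2j) 1≤j j∣ (λ _ → σ₂≡1′)) ⟩
  1ℤ
    ∎
  where
  open ≡-Reasoning
  H = odd K
  1≤j : 1 ≤ j
  1≤j = ℕP.n≢0⇒n>0 (λ j≡0 → ℕP.<-irrefl refl (subst (λ y → 1 ≤ 2 ℕ.* y) j≡0 1≤x))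
  j<2j : j < 2 ℕ.* j
  j<2j = ℕP.m<m+n j (ℕP.≤-trans 1≤j (ℕP.m≤m+n j 0))
  2∣ : 2 ℕD.∣ suc (odd H)
  2∣ = ℕD.∣-trans (ℕD.m∣m*n j) x∣
  j∣ : j ℕD.∣ suc (odd H)
  j∣ = ℕD.∣-trans (ℕD.n∣m*n 2) x∣
  σ₂≡1′ : gaussSign H (+ 2) ≡ 1ℤ
  σ₂≡1′ = σ₂≡1 (ℕD.m∣m*n j)

suc-odd-odd : ∀ K → suc (odd (odd K)) ≡ 4 ℕ.* suc K
suc-odd-odd K = expand K
  where
  expand : ∀ K → suc (suc (2 ℕ.* suc (2 ℕ.* K))) ≡ 4 ℕ.* suc K
  expand = ℕSolver.solve-∀

factor∣suc-odd-odd : ∀ {K d n} → suc K ≡ d ℕ.* n → n ℕD.∣ suc (odd (odd K))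
factor∣suc-odd-odd {K} {d} {n} 1+K≡dn =
  ℕD.divides (4 ℕ.* d) (trans (suc-odd-odd K) (trans (cong (4 ℕ.*_) 1+K≡dn) (sym (ℕP.*-assoc 4 d n))))

gaussSign-factor : ∀ {K d n} → suc K ≡ d ℕ.* n → 1 ≤ n → gaussSign (odd K) (+ n) ≡ 1ℤ
gaussSign-factor {K} {d} {n} 1+K≡dn 1≤n =
  gaussSign-divisor-of-suc K n (<-wellFounded n) 1≤n (factor∣suc-odd-odd {K} {d} 1+K≡dn) σ₂≡1
  where
  σ₂≡1 : 2 ℕD.∣ n → gaussSign (odd K) (+ 2) ≡ 1ℤ
  σ₂≡1 (ℕD.divides q n≡q*2) = begin
    gaussSign (odd K) (+ 2)      ≡⟨ gaussSign-two K ⟩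
    -1ℤ ^ suc K                  ≡⟨ cong (-1ℤ ^_) (trans 1+K≡dn (cong (d ℕ.*_) n≡q*2)) ⟩
    -1ℤ ^ (d ℕ.* (q ℕ.* 2))      ≡⟨ cong (-1ℤ ^_) (rearrange d q) ⟩
    -1ℤ ^ (2 ℕ.* (d ℕ.* q))      ≡⟨ -1^-even (d ℕ.* q) ⟩
    1ℤ                           ∎
    where
    open ≡-Reasoning
    rearrange : ∀ d q → d ℕ.* (q ℕ.* 2) ≡ 2 ℕ.* (d ℕ.* q)
    rearrange = ℕSolver.solve-∀

corollary1 : (d n : ℕ) → 1 ℕ.≤ d → 1 ℕ.≤ n →
    JacobiIs (- (+ n)) (4 ℕ.* d ℕ.* n ℕ.∸ 1) -1ℤ
    × (Prime (4 ℕ.* d ℕ.* n ℕ.∸ 1) → legendre (+ n) (4 ℕ.* d ℕ.* n ℕ.∸ 1) ≡ 1ℤ)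
corollary1 d@(suc d₁) n@(suc n₁) _ _ = jacobi , legendre≡1
  where
  K = n₁ ℕ.+ d₁ ℕ.* n
  H = odd K
  1+K≡dn : suc K ≡ d ℕ.* n
  1+K≡dn = refl
  m≡odd : 4 ℕ.* d ℕ.* n ℕ.∸ 1 ≡ odd H
  m≡odd = cong ℕ.pred (trans (ℕP.*-assoc 4 d n) (trans (cong (4 ℕ.*_) (sym 1+K≡dn)) (sym (suc-odd-odd K))))
  H⊥n : Coprime (+ odd H) (+ n)
  H⊥n = divisor-of-suc-coprime (factor∣suc-odd-odd {K} {d} 1+K≡dn)
  σn≡1 : gaussSign H (+ n) ≡ 1ℤ
  σn≡1 = gaussSign-factor {K} {d} 1+K≡dn (s≤s z≤n)
  jacobi : JacobiIs (- (+ n)) (4 ℕ.* d ℕ.* n ℕ.∸ 1) -1ℤ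
  jacobi ps ps-prime ∏ps≡m = begin
    legendreProduct (- (+ n)) ps      ≡⟨ schering {H} { - (+ n)} H⊥n ps ps-prime (trans ∏ps≡m m≡odd) ⟩
    gaussSign H (- (+ n))             ≡⟨ gaussSign-negate H (+ n) H⊥n ⟩
    -1ℤ ^ H * gaussSign H (+ n)       ≡⟨ cong₂ _*_ (-1^-odd K) σn≡1 ⟩
    -1ℤ                               ∎
    where open ≡-Reasoning
  legendre≡1 : Prime (4 ℕ.* d ℕ.* n ℕ.∸ 1) → legendre (+ n) (4 ℕ.* d ℕ.* n ℕ.∸ 1) ≡ 1ℤ
  legendre≡1 m-prime rewrite m≡odd = trans (legendre≡gaussSign H (+ n) m-prime H∤n) σn≡1
    where
    H∤n : ¬ (+ odd H ∣ + n)
    H∤n H∣n = ℕP.<⇒≢ (prime>1 m-prime) (sym (H⊥n (ℕD.∣-refl , ∣⇒∣ᵤ H∣n)))
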